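{- Let $\sigma\in\{\mu,\mu_o,\mu_d,\mu_t\}$ and let $p,q$ be integers with $2\le p\le q$. Then there exist a connected graph $G$ and a vertex $x\in V(G)$ with $G-x$ connected such that $\sigma(G)=q$ and $\sigma(G-x)=p$.
   Context: All graphs are finite, simple and connected; $G-x$ is the graph obtained by deleting $x$ and its incident edges. For a connected graph $G$ and $X\subseteq V(G)$, two vertices $u,v$ are $X$-visible if there is a shortest $u,v$-path $P$ in $G$ with $V(P)\cap X\subseteq\{u,v\}$. $X$ is a mutual-visibility set if all $u,v\in X$ are $X$-visible; an outer mutual-visibility set if all $u\in X$, $v\in V(G)$ are $X$-visible; a dual mutual-visibility set if all $u,v$ with $u,v\in X$ or $u,v\in V(G)\setminus X$ are $X$-visible; a total mutual-visibility set if all $u,v\in V(G)$ are $X$-visible. $\mu(G),\mu_o(G),\mu_d(G),\mu_t(G)$ denote the maximum cardinalities of such sets, respectively. -}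

module Defs where

open import Data.Nat using (ℕ; zero; suc; _≤_)
open import Data.Fin using (Fin; zero; suc; fromℕ; inject₁; punchIn)
open import Data.Fin.Subset using (Subset; _∈_; _∉_; ∣_∣)
open import Data.Bool using (Bool; true; false)
open import Data.Product using (Σ; ∃; _×_; _,_)
open import Data.Sum using (_⊎_)
open import Relation.Binary.PropositionalEquality using (_≡_)

record Graph (n : ℕ) : Set where
  field
    adj    : Fin n → Fin n → Bool
    sym    : ∀ i j → adj i j ≡ adj j i
    irrefl : ∀ i → adj i i ≡ false
open Graph public

Walk : ∀ {n} → Graph n → Fin n → Fin n → (k : ℕ) → (Fin (suc k) → Fin n) → Set
Walk G u v k w =
  (w zero ≡ u) × (w (fromℕ k) ≡ v) × (∀ (i : Fin k) → adj G (w (inject₁ i)) (w (suc i)) ≡ true)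

Connected : ∀ {n} → Graph n → Set
Connected {n} G = ∀ (u v : Fin n) → Σ ℕ λ k → Σ (Fin (suc k) → Fin n) λ w → Walk G u v k w

-- A shortest u,v-path: a walk of minimum length (hence a path).
ShortestPath : ∀ {n} → Graph n → Fin n → Fin n → (k : ℕ) → (Fin (suc k) → Fin n) → Set
ShortestPath {n} G u v k w =
  Walk G u v k w × (∀ (k' : ℕ) (w' : Fin (suc k') → Fin n) → Walk G u v k' w' → k ≤ k')

Visible : ∀ {n} → Graph n → Subset n → Fin n → Fin n → Set
Visible {n} G X u v =
  Σ ℕ λ k → Σ (Fin (suc k) → Fin n) λ w →
    ShortestPath G u v k w × (∀ (i : Fin (suc k)) → w i ∈ X → (w i ≡ u) ⊎ (w i ≡ v))

data Kind : Set where
  μ μo μd μt : Kind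

IsVisSet : Kind → ∀ {n} → Graph n → Subset n → Set
IsVisSet μ  {n} G X = ∀ (u v : Fin n) → u ∈ X → v ∈ X → Visible G X u v
IsVisSet μo {n} G X = ∀ (u v : Fin n) → u ∈ X → Visible G X u v
IsVisSet μd {n} G X = ∀ (u v : Fin n) → ((u ∈ X × v ∈ X) ⊎ (u ∉ X × v ∉ X)) → Visible G X u v
IsVisSet μt {n} G X = ∀ (u v : Fin n) → Visible G X u v

HasValue : Kind → ∀ {n} → Graph n → ℕ → Set
HasValue σ {n} G m =
  (Σ (Subset n) λ X → IsVisSet σ G X × ∣ X ∣ ≡ m) × (∀ (X : Subset n) → IsVisSet σ G X → ∣ X ∣ ≤ m)

deleteVertex : ∀ {m} → Graph (suc m) → Fin (suc m) → Graph m
deleteVertex G x = record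
  { adj    = λ i j → adj G (punchIn x i) (punchIn x j)
  ; sym    = λ i j → Graph.sym G (punchIn x i) (punchIn x j)
  ; irrefl = λ i → irrefl G (punchIn x i)
  }

-- For q = p, take a clique on p vertices with a pendant vertex and delete the pendant vertex.
-- For q > p, take the cone over the lollipop L made of a clique on p vertices with a path of q − p
-- vertices attached, and delete the apex. In L, the far end of the tail together with the clique
-- minus its attachment vertex is a total mutual-visibility set of size p. Conversely, a shortest
-- path between two vertices of L on opposite sides of a tail vertex y passes through y, so a
-- mutual-visibility set of L either has at most two vertices or contains at most one vertex of the
-- tail and its attachment vertex. In the cone all non-apex vertices form a total mutual-visibility set, and no
-- mutual-visibility set contains every vertex, since two non-adjacent vertices need an interior
-- vertex on their shortest path. As every σ-set is a mutual-visibility set and every total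
-- mutual-visibility set is a σ-set, all four invariants agree on these graphs.

module Submission where

open import Defs hiding (sym)
open import Data.Bool using (Bool; true; false)
open import Data.Empty using (⊥; ⊥-elim)
open import Data.Fin using (Fin; zero; suc; toℕ; fromℕ; fromℕ<; inject₁; opposite; punchOut; _↑ʳ_)
open import Data.Fin.Properties
  using (toℕ-injective; toℕ-inject₁; toℕ-fromℕ<; toℕ<n; punchOut-injective; opposite-involutive; any?)
  renaming (suc-injective to Fin-suc-injective; _≟_ to _≟ᶠ_)
open import Data.Fin.Subset using (Subset; _∈_; _∉_; ∣_∣; ⊤; inside; outside) renaming (⊥ to ∅)
open import Data.Fin.Subset.Properties using (∈⊤; ∣⊤∣≡n; ∣p∣≤n; ∣p∣≡n⇒p≡⊤; _∈?_)
open import Data.Nat using (ℕ; zero; suc; _≤_; _<_; _+_; _∸_; _⊓_; z≤n; s≤s; s≤s⁻¹; _≤?_; _<?_)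
open import Data.Nat.Properties
open import Data.Product using (Σ; ∃; _×_; _,_; proj₁; proj₂)
open import Data.Sum using (_⊎_; inj₁; inj₂)
open import Data.Vec using ([]; _∷_; _++_; here; there)
import Data.Vec.Functional as Vector
open import Function using (_∘_)
open import Function.Bundles using (_⇔_; mk⇔; Equivalence)
open import Function.Construct.Composition using (_⇔-∘_)
open import Relation.Binary using (tri<; tri≈; tri>)
open import Relation.Binary.PropositionalEquality
open import Relation.Nullary using (¬_; Dec; yes; no; does; contradiction; ¬?; _×-dec_; _⊎-dec_)
open import Relation.Nullary.Decidable using (dec-false; does-⇔)

injective⇒∣p∣≤n : ∀ {n m} (p : Subset n) (f : ∀ i → i ∈ p → Fin m) →
  (∀ i j (i∈p : i ∈ p) (j∈p : j ∈ p) → f i i∈p ≡ f j j∈p → i ≡ j) → ∣ p ∣ ≤ m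
injective⇒∣p∣≤n [] f f-inj = z≤n
injective⇒∣p∣≤n (outside ∷ p) f f-inj =
  injective⇒∣p∣≤n p (λ i i∈p → f (suc i) (there i∈p))
    (λ i j i∈p j∈p eq → Fin-suc-injective (f-inj (suc i) (suc j) (there i∈p) (there j∈p) eq))
injective⇒∣p∣≤n {m = zero} (inside ∷ p) f f-inj with f zero here
... | ()
injective⇒∣p∣≤n {m = suc m} (inside ∷ p) f f-inj = s≤s (injective⇒∣p∣≤n p g g-inj)
  where
  f0≢f : ∀ i (i∈p : i ∈ p) → f zero here ≢ f (suc i) (there i∈p)
  f0≢f i i∈p eq with f-inj zero (suc i) here (there i∈p) eq
  ... | ()
  g : ∀ i → i ∈ p → Fin m
  g i i∈p = punchOut (f0≢f i i∈p)
  g-inj : ∀ i j (i∈p : i ∈ p) (j∈p : j ∈ p) → g i i∈p ≡ g j j∈p → i ≡ j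
  g-inj i j i∈p j∈p eq = Fin-suc-injective
    (f-inj (suc i) (suc j) (there i∈p) (there j∈p) (punchOut-injective (f0≢f i i∈p) (f0≢f j j∈p) eq))

⊆pair⇒∣p∣≤2 : ∀ {n} (p : Subset n) (a b : Fin n) → (∀ i → i ∈ p → i ≡ a ⊎ i ≡ b) → ∣ p ∣ ≤ 2
⊆pair⇒∣p∣≤2 p a b p⊆ab = injective⇒∣p∣≤n p (λ i _ → side i) side-injective
  where
  side : Fin _ → Fin 2
  side i with i ≟ᶠ a
  ... | yes _ = zero
  ... | no _ = suc zero
  side-injective : ∀ i j (i∈p : i ∈ p) (j∈p : j ∈ p) → side i ≡ side j → i ≡ j
  side-injective i j i∈p j∈p eq with i ≟ᶠ a | j ≟ᶠ a | p⊆ab i i∈p | p⊆ab j j∈p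
  ... | yes i≡a | yes j≡a | _        | _        = trans i≡a (sym j≡a)
  ... | no i≢a  | _       | inj₁ i≡a | _        = contradiction i≡a i≢a
  ... | _       | no j≢a  | _        | inj₁ j≡a = contradiction j≡a j≢a
  ... | no _    | no _    | inj₂ i≡b | inj₂ j≡b = trans i≡b (sym j≡b)

∣∅++p∣≡∣p∣ : ∀ k {n} (p : Subset n) → ∣ ∅ {k} ++ p ∣ ≡ ∣ p ∣
∣∅++p∣≡∣p∣ zero p = refl
∣∅++p∣≡∣p∣ (suc k) p = ∣∅++p∣≡∣p∣ k p

x∈∅++p⇒k≤x : ∀ k {n} {p : Subset n} {x : Fin (k + n)} → x ∈ ∅ {k} ++ p → k ≤ toℕ x
x∈∅++p⇒k≤x zero _ = z≤n
x∈∅++p⇒k≤x (suc k) {x = suc x} (there x∈) = s≤s (x∈∅++p⇒k≤x k x∈)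

∸-injective-above : ∀ {a b} c → (a ≤ c → b ≤ c → a ≡ b) → a ∸ c ≡ b ∸ c → a ≡ b
∸-injective-above {a} {b} c low-injective eq with a ≤? c | b ≤? c
... | yes a≤c | yes b≤c = low-injective a≤c b≤c
... | yes a≤c | no b≰c = contradiction (trans (sym (m≤n⇒m∸n≡0 a≤c)) eq) (≢-sym (>⇒≢ (m<n⇒0<n∸m (≰⇒> b≰c))))
... | no a≰c  | yes b≤c = contradiction (trans eq (m≤n⇒m∸n≡0 b≤c)) (>⇒≢ (m<n⇒0<n∸m (≰⇒> a≰c)))
... | no a≰c  | no b≰c = ∸-cancelʳ-≡ (<⇒≤ (≰⇒> a≰c)) (<⇒≤ (≰⇒> b≰c)) eq

opposite-inject₁ : ∀ {k} (i : Fin k) → opposite (inject₁ i) ≡ suc (opposite i)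
opposite-inject₁ zero = refl
opposite-inject₁ (suc i) = cong inject₁ (opposite-inject₁ i)

module _ {n} (G : Graph n) where

  adjacent⇒≢ : ∀ {u v} → adj G u v ≡ true → u ≢ v
  adjacent⇒≢ {u} uv refl = contradiction (trans (sym uv) (irrefl G u)) λ ()

  walk-stay : ∀ v → Walk G v v 0 (λ _ → v)
  walk-stay v = refl , refl , λ ()

  walk-cons : ∀ {u x v k w} → adj G u x ≡ true → Walk G x v k w → Walk G u v (suc k) (u Vector.∷ w)
  walk-cons ux (refl , w-last , steps) = refl , w-last , λ { zero → ux ; (suc i) → steps i }

  walk-reverse : ∀ {u v k w} → Walk G u v k w → Walk G v u k (w ∘ opposite)
  walk-reverse {k = k} {w} (w-first , w-last , steps) =
    w-last , trans (cong w (opposite-involutive zero)) w-first , reversed-steps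
    where
    reversed-steps : ∀ i → adj G (w (opposite (inject₁ i))) (w (opposite (suc i))) ≡ true
    reversed-steps i rewrite opposite-inject₁ i = trans (Graph.sym G _ _) (steps (opposite i))

  walk-length≥1 : ∀ {u v k w} → Walk G u v k w → u ≢ v → 1 ≤ k
  walk-length≥1 {k = zero} (refl , refl , _) u≢v = contradiction refl u≢v
  walk-length≥1 {k = suc k} _ _ = s≤s z≤n

  walk-length≥2 : ∀ {u v k w} → Walk G u v k w → u ≢ v → adj G u v ≡ false → 2 ≤ k
  walk-length≥2 {k = zero} (refl , refl , _) u≢v _ = contradiction refl u≢v
  walk-length≥2 {k = suc zero} (refl , refl , steps) _ ¬uv = contradiction (trans (sym (steps zero)) ¬uv) λ ()
  walk-length≥2 {k = suc (suc k)} _ _ _ = s≤s (s≤s z≤n)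

  visible-sym : ∀ {X u v} → Visible G X u v → Visible G X v u
  visible-sym {X} {u} {v} (k , w , (walk , shortest) , clean) =
    k , w ∘ opposite , (walk-reverse {w = w} walk , shortest-reversed) , clean-reversed
    where
    shortest-reversed : ∀ k' w' → Walk G v u k' w' → k ≤ k'
    shortest-reversed k' w' walk' = shortest k' (w' ∘ opposite) (walk-reverse {w = w'} walk')
    clean-reversed : ∀ i → w (opposite i) ∈ X → w (opposite i) ≡ v ⊎ w (opposite i) ≡ u
    clean-reversed i w∈X with clean (opposite i) w∈X
    ... | inj₁ w≡u = inj₂ w≡u
    ... | inj₂ w≡v = inj₁ w≡v

  visible-refl : ∀ X u → Visible G X u u
  visible-refl X u = 0 , (λ _ → u) , (walk-stay u , λ _ _ _ → z≤n) , λ _ _ → inj₁ refl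

  visible-adjacent : ∀ X {u v} → adj G u v ≡ true → Visible G X u v
  visible-adjacent X {u} {v} uv =
    1 , u Vector.∷ (λ _ → v) ,
    (walk-cons uv (walk-stay v) , λ _ w' walk → walk-length≥1 {w = w'} walk (adjacent⇒≢ uv)) , clean
    where
    clean : ∀ i → (u Vector.∷ (λ _ → v)) i ∈ X → _
    clean zero _ = inj₁ refl
    clean (suc zero) _ = inj₂ refl

  visible-via : ∀ X {u x v} → u ≢ v → adj G u v ≡ false →
    adj G u x ≡ true → adj G x v ≡ true → x ∉ X → Visible G X u v
  visible-via X {u} {x} {v} u≢v ¬uv ux xv x∉X =
    2 , u Vector.∷ x Vector.∷ (λ _ → v) ,
    (walk-cons ux (walk-cons xv (walk-stay v)) , λ _ w' walk → walk-length≥2 {w = w'} walk u≢v ¬uv) , clean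
    where
    clean : ∀ i → (u Vector.∷ x Vector.∷ (λ _ → v)) i ∈ X → _
    clean zero _ = inj₁ refl
    clean (suc zero) x∈X = contradiction x∈X x∉X
    clean (suc (suc zero)) _ = inj₂ refl

  ¬visible-⊤ : ∀ {u v} → u ≢ v → adj G u v ≡ false → ¬ Visible G ⊤ u v
  ¬visible-⊤ u≢v ¬uv (zero , w , ((refl , refl , _) , _) , _) = u≢v refl
  ¬visible-⊤ u≢v ¬uv (suc k , w , ((refl , refl , steps) , _) , clean) with clean (suc zero) ∈⊤
  ... | inj₁ w₁≡u = adjacent⇒≢ (steps zero) (sym w₁≡u)
  ... | inj₂ w₁≡v = contradiction (trans (sym (steps zero)) (trans (cong (adj G _) w₁≡v) ¬uv)) λ ()

module _ {n} (G : Graph n) where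

  isVisSet⇒mutual : ∀ σ {X} → IsVisSet σ G X → IsVisSet μ G X
  isVisSet⇒mutual μ  vis = vis
  isVisSet⇒mutual μo vis u v u∈X _ = vis u v u∈X
  isVisSet⇒mutual μd vis u v u∈X v∈X = vis u v (inj₁ (u∈X , v∈X))
  isVisSet⇒mutual μt vis u v _ _ = vis u v

  total⇒isVisSet : ∀ σ {X} → IsVisSet μt G X → IsVisSet σ G X
  total⇒isVisSet μ  vis u v _ _ = vis u v
  total⇒isVisSet μo vis u v _ = vis u v
  total⇒isVisSet μd vis u v _ = vis u v
  total⇒isVisSet μt vis = vis

  total⇒connected : ∀ {X} → IsVisSet μt G X → Connected G
  total⇒connected vis u v with vis u v
  ... | k , w , (walk , _) , _ = k , w , walk

  total-and-mutual-bound⇒hasValue : ∀ {X m} → IsVisSet μt G X → ∣ X ∣ ≡ m →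
    (∀ Y → IsVisSet μ G Y → ∣ Y ∣ ≤ m) → ∀ σ → HasValue σ G m
  total-and-mutual-bound⇒hasValue {X} vis ∣X∣≡m bound σ =
    (X , total⇒isVisSet σ vis , ∣X∣≡m) , λ Y Y-vis → bound Y (isVisSet⇒mutual σ Y-vis)

mutual-bound-noncomplete : ∀ {n} (G : Graph (suc n)) {u v} → u ≢ v → adj G u v ≡ false →
  ∀ Y → IsVisSet μ G Y → ∣ Y ∣ ≤ n
mutual-bound-noncomplete G {u} {v} u≢v ¬uv Y Y-mutual =
  s≤s⁻¹ (≤∧≢⇒< (∣p∣≤n Y) (λ ∣Y∣≡ → ¬⊤ (∣p∣≡n⇒p≡⊤ ∣Y∣≡)))
  where
  ¬⊤ : Y ≢ ⊤
  ¬⊤ refl = ¬visible-⊤ G u≢v ¬uv (Y-mutual u v ∈⊤ ∈⊤)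

RisesByAtMostOne : (k : ℕ) → (Fin (suc k) → ℕ) → Set
RisesByAtMostOne k s = ∀ (i : Fin k) → s (suc i) ≤ suc (s (inject₁ i))

risesByAtMostOne⇒last≤ : ∀ k s → RisesByAtMostOne k s → s (fromℕ k) ≤ s zero + k
risesByAtMostOne⇒last≤ zero s rises = ≤-reflexive (sym (+-identityʳ _))
risesByAtMostOne⇒last≤ (suc k) s rises = begin
  s (fromℕ (suc k))   ≤⟨ risesByAtMostOne⇒last≤ k (s ∘ suc) (rises ∘ suc) ⟩
  s (suc zero) + k    ≤⟨ +-monoˡ-≤ k (rises zero) ⟩
  suc (s zero) + k    ≡⟨ +-suc (s zero) k ⟨
  s zero + suc k      ∎
  where open ≤-Reasoning

risesByAtMostOne⇒hits : ∀ k s b → RisesByAtMostOne k s → s zero ≤ b → b ≤ s (fromℕ k) → ∃ λ i → s i ≡ b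
risesByAtMostOne⇒hits zero s b _ s₀≤b b≤s₀ = zero , ≤-antisym s₀≤b b≤s₀
risesByAtMostOne⇒hits (suc k) s b rises s₀≤b b≤last with s zero ≟ b
... | yes s₀≡b = zero , s₀≡b
... | no s₀≢b with risesByAtMostOne⇒hits k (s ∘ suc) b (rises ∘ suc) (≤-trans (rises zero) (≤∧≢⇒< s₀≤b s₀≢b)) b≤last
... | i , sᵢ≡b = suc i , sᵢ≡b

coneAdj : ∀ {n} → Graph n → Fin (suc n) → Fin (suc n) → Bool
coneAdj H zero    zero    = false
coneAdj H zero    (suc _) = true
coneAdj H (suc _) zero    = true
coneAdj H (suc i) (suc j) = adj H i j

cone : ∀ {n} → Graph n → Graph (suc n)
cone H = record { adj = coneAdj H ; sym = cone-sym ; irrefl = cone-irrefl }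
  where
  cone-sym : ∀ i j → coneAdj H i j ≡ coneAdj H j i
  cone-sym zero    zero    = refl
  cone-sym zero    (suc _) = refl
  cone-sym (suc _) zero    = refl
  cone-sym (suc i) (suc j) = Graph.sym H i j
  cone-irrefl : ∀ i → coneAdj H i i ≡ false
  cone-irrefl zero    = refl
  cone-irrefl (suc i) = irrefl H i

module _ {n} (H : Graph n) where

  cone-total : IsVisSet μt (cone H) (outside ∷ ⊤)
  cone-total zero    zero    = visible-refl (cone H) _ zero
  cone-total zero    (suc j) = visible-adjacent (cone H) _ refl
  cone-total (suc i) zero    = visible-adjacent (cone H) _ refl
  cone-total (suc i) (suc j) with i ≟ᶠ j | adj H i j in ij
  ... | yes refl | _     = visible-refl (cone H) _ (suc i)
  ... | no i≢j   | true  = visible-adjacent (cone H) _ ij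
  ... | no i≢j   | false = visible-via (cone H) _ {x = zero} (i≢j ∘ Fin-suc-injective) ij refl refl λ ()

  cone-connected : Connected (cone H)
  cone-connected = total⇒connected (cone H) cone-total

  cone-hasValue : ∀ {u v} → u ≢ v → adj H u v ≡ false → ∀ σ → HasValue σ (cone H) n
  cone-hasValue u≢v ¬uv = total-and-mutual-bound⇒hasValue (cone H) cone-total (∣⊤∣≡n n)
    (mutual-bound-noncomplete (cone H) (u≢v ∘ Fin-suc-injective) ¬uv)

-- Vertices 0, …, c - 1 form a path (the tail), the vertices ≥ c a clique; the edge (c - 1, c)
-- joins the two.
LollipopEdge : ℕ → ℕ → ℕ → Set
LollipopEdge c a b = a ≢ b × (suc a ≡ b ⊎ suc b ≡ a ⊎ (c ≤ a × c ≤ b))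

lollipopEdge? : ∀ c a b → Dec (LollipopEdge c a b)
lollipopEdge? c a b = ¬? (a ≟ b) ×-dec ((suc a ≟ b) ⊎-dec ((suc b ≟ a) ⊎-dec ((c ≤? a) ×-dec (c ≤? b))))

lollipopEdge-sym : ∀ {c a b} → LollipopEdge c a b → LollipopEdge c b a
lollipopEdge-sym (a≢b , inj₁ e) = ≢-sym a≢b , inj₂ (inj₁ e)
lollipopEdge-sym (a≢b , inj₂ (inj₁ e)) = ≢-sym a≢b , inj₁ e
lollipopEdge-sym (a≢b , inj₂ (inj₂ (c≤a , c≤b))) = ≢-sym a≢b , inj₂ (inj₂ (c≤b , c≤a))

lollipopEdge-suc : ∀ {c a b} → LollipopEdge (suc c) (suc a) (suc b) ⇔ LollipopEdge c a b
lollipopEdge-suc = mk⇔ shrink grow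
  where
  shrink : ∀ {c a b} → LollipopEdge (suc c) (suc a) (suc b) → LollipopEdge c a b
  shrink (a≢b , inj₁ e) = a≢b ∘ cong suc , inj₁ (suc-injective e)
  shrink (a≢b , inj₂ (inj₁ e)) = a≢b ∘ cong suc , inj₂ (inj₁ (suc-injective e))
  shrink (a≢b , inj₂ (inj₂ (s≤s c≤a , s≤s c≤b))) = a≢b ∘ cong suc , inj₂ (inj₂ (c≤a , c≤b))
  grow : ∀ {c a b} → LollipopEdge c a b → LollipopEdge (suc c) (suc a) (suc b)
  grow (a≢b , inj₁ e) = a≢b ∘ suc-injective , inj₁ (cong suc e)
  grow (a≢b , inj₂ (inj₁ e)) = a≢b ∘ suc-injective , inj₂ (inj₁ (cong suc e))
  grow (a≢b , inj₂ (inj₂ (c≤a , c≤b))) = a≢b ∘ suc-injective , inj₂ (inj₂ (s≤s c≤a , s≤s c≤b))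

does≡true⇔ : ∀ {A : Set} (a? : Dec A) → does a? ≡ true ⇔ A
does≡true⇔ (yes a) = mk⇔ (λ _ → a) (λ _ → refl)
does≡true⇔ (no ¬a) = mk⇔ (λ ()) (λ a → contradiction a ¬a)

lollipop : ℕ → (n : ℕ) → Graph n
lollipop c n = record
  { adj = λ i j → does (lollipopEdge? c (toℕ i) (toℕ j))
  ; sym = λ i j → does-⇔ (mk⇔ lollipopEdge-sym lollipopEdge-sym)
                   (lollipopEdge? c (toℕ i) (toℕ j)) (lollipopEdge? c (toℕ j) (toℕ i))
  ; irrefl = λ i → dec-false (lollipopEdge? c (toℕ i) (toℕ i)) (λ e → proj₁ e refl)
  }

IsLollipop : ℕ → ∀ {n} → Graph n → Set
IsLollipop c {n} H = ∀ (i j : Fin n) → adj H i j ≡ true ⇔ LollipopEdge c (toℕ i) (toℕ j)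

lollipop-isLollipop : ∀ c n → IsLollipop c (lollipop c n)
lollipop-isLollipop c n i j = does≡true⇔ (lollipopEdge? c (toℕ i) (toℕ j))

lollipop-delete-tail-end : ∀ c n → IsLollipop c (deleteVertex (lollipop (suc c) (suc n)) zero)
lollipop-delete-tail-end c n i j = lollipopEdge-suc ⇔-∘ does≡true⇔ (lollipopEdge? (suc c) _ _)

module Lollipop (c r : ℕ) {H : Graph (suc (c + suc r))} (isLollipop : IsLollipop c H) where

  private
    Vertex : Set
    Vertex = Fin (suc (c + suc r))

  edge⇒adj : ∀ {i j} → LollipopEdge c (toℕ i) (toℕ j) → adj H i j ≡ true
  edge⇒adj {i} {j} = Equivalence.from (isLollipop i j)

  adj⇒edge : ∀ {i j} → adj H i j ≡ true → LollipopEdge c (toℕ i) (toℕ j)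
  adj⇒edge {i} {j} = Equivalence.to (isLollipop i j)

  -- The index truncated at c + 1 rises by at most one along an edge. This bounds distances from
  -- below and forces a walk to pass through every tail vertex it climbs over.
  height : ℕ → ℕ
  height a = a ⊓ suc c

  height-edge : ∀ {a b} → LollipopEdge c a b → height b ≤ suc (height a)
  height-edge {a} (_ , inj₁ refl) = s≤s (⊓-monoʳ-≤ a (n≤1+n c))
  height-edge {suc b} {b} (_ , inj₂ (inj₁ refl)) = ≤-trans (⊓-monoˡ-≤ (suc c) (n≤1+n b)) (n≤1+n _)
  height-edge {a} {b} (_ , inj₂ (inj₂ (c≤a , _))) = ≤-trans (m⊓n≤n b (suc c)) (s≤s (⊓-glb c≤a (n≤1+n c)))

  height-below : ∀ {a} → a ≤ suc c → height a ≡ a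
  height-below = m≤n⇒m⊓n≡m

  height≡⇒≡ : ∀ {a b} → height a ≡ b → b ≤ c → a ≡ b
  height≡⇒≡ {a} h≡b b≤c with a ≤? suc c
  ... | yes a≤ = trans (sym (height-below a≤)) h≡b
  ... | no a≰ = contradiction (≤-trans (≤-reflexive (trans (sym (m≥n⇒m⊓n≡n (<⇒≤ (≰⇒> a≰)))) h≡b)) b≤c) 1+n≰n

  walk-rises : ∀ {u v k w} → Walk H u v k w → RisesByAtMostOne k (height ∘ toℕ ∘ w)
  walk-rises (_ , _ , steps) i = height-edge (adj⇒edge (steps i))

  walk-climb : ∀ {u v k w} → Walk H u v k w → height (toℕ v) ≤ height (toℕ u) + k
  walk-climb {k = k} {w} walk@(refl , refl , _) =
    risesByAtMostOne⇒last≤ k (height ∘ toℕ ∘ w) (walk-rises {w = w} walk)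

  walk-visits : ∀ {x y z k w} → toℕ x < toℕ y → toℕ y < toℕ z → toℕ y ≤ c →
    Walk H x z k w → ∃ λ i → w i ≡ y
  walk-visits {y = y} {k = k} {w} x<y y<z y≤c walk@(refl , refl , _)
    with risesByAtMostOne⇒hits k (height ∘ toℕ ∘ w) (toℕ y) (walk-rises {w = w} walk)
           (≤-trans (m⊓n≤m _ _) (<⇒≤ x<y)) (⊓-glb (<⇒≤ y<z) (≤-trans y≤c (n≤1+n c)))
  ... | i , hᵢ≡y = i , toℕ-injective (height≡⇒≡ hᵢ≡y y≤c)

  descent-length : ∀ {u v k w} → toℕ u ≤ suc c → Walk H v u k w → height (toℕ v) ∸ toℕ u ≤ k
  descent-length {u} {v} {k} {w} u≤ walk = m≤n+o⇒m∸n≤o _ (toℕ u)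
    (subst (λ h → height (toℕ v) ≤ h + k) (height-below u≤) (walk-climb {w = w ∘ opposite} (walk-reverse H {w = w} walk)))

  consecutive⇒adj : ∀ {i j} → suc (toℕ j) ≡ toℕ i → adj H i j ≡ true
  consecutive⇒adj j+1≡i = edge⇒adj ((λ i≡j → 1+n≢n (trans j+1≡i i≡j)) , inj₂ (inj₁ j+1≡i))

  descent : ∀ d (u v : Vertex) → toℕ v ≡ d + toℕ u →
    Σ (Fin (suc d) → Vertex) λ w →
      Walk H v u d w × (∀ i → toℕ u ≤ toℕ (w i) × toℕ (w i) ≤ toℕ v)
  descent zero u v v≡u = (λ _ → v) , (refl , toℕ-injective v≡u , λ ()) , λ _ → ≤-reflexive (sym v≡u) , ≤-refl
  descent (suc d) u (suc v) v+1≡ with descent d u (inject₁ v) (trans (toℕ-inject₁ v) (suc-injective v+1≡))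
  ... | w , walk , bounds =
    suc v Vector.∷ w , walk-cons H (consecutive⇒adj (cong suc (toℕ-inject₁ v))) walk , bounds′
    where
    bounds′ : ∀ i → toℕ u ≤ toℕ ((suc v Vector.∷ w) i) × toℕ ((suc v Vector.∷ w) i) ≤ suc (toℕ v)
    bounds′ zero = ≤-trans (m≤n+m (toℕ u) (suc d)) (≤-reflexive (sym v+1≡)) , ≤-refl
    bounds′ (suc i) = proj₁ (bounds i) , ≤-trans (proj₂ (bounds i)) (≤-trans (≤-reflexive (toℕ-inject₁ v)) (n≤1+n _))

  corner : Vertex
  corner = fromℕ< (s≤s (m≤m+n c (suc r)))

  toℕ-corner : toℕ corner ≡ c
  toℕ-corner = toℕ-fromℕ< (s≤s (m≤m+n c (suc r)))

  X : Subset (suc (c + suc r))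
  X = inside ∷ (∅ {c} ++ ⊤)

  ∣X∣ : ∣ X ∣ ≡ suc (suc r)
  ∣X∣ = cong suc (trans (∣∅++p∣≡∣p∣ c ⊤) (∣⊤∣≡n (suc r)))

  X-tail-vertex : ∀ {u x} → toℕ u ≤ toℕ x → toℕ x ≤ c → x ∈ X → x ≡ u
  X-tail-vertex {x = zero} u≤0 _ here = toℕ-injective (sym (n≤0⇒n≡0 u≤0))
  X-tail-vertex {x = suc x} _ x<c (there x∈) = contradiction x<c (<⇒≱ (s≤s (x∈∅++p⇒k≤x c x∈)))

  visible-down-within-tail : ∀ {u v} → toℕ u < toℕ v → toℕ v ≤ c → Visible H X v u
  visible-down-within-tail {u} {v} u<v v≤c with descent (toℕ v ∸ toℕ u) u v (sym (m∸n+n≡m (<⇒≤ u<v)))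
  ... | w , walk , bounds = toℕ v ∸ toℕ u , w , (walk , shortest) , clean
    where
    shortest : ∀ k w′ → Walk H v u k w′ → toℕ v ∸ toℕ u ≤ k
    shortest k w′ walk′ = subst (λ h → h ∸ toℕ u ≤ k) (height-below (≤-trans v≤c (n≤1+n c)))
      (descent-length {w = w′} (≤-trans (<⇒≤ u<v) (≤-trans v≤c (n≤1+n c))) walk′)
    clean : ∀ i → w i ∈ X → w i ≡ v ⊎ w i ≡ u
    clean i wᵢ∈X = inj₂ (X-tail-vertex (proj₁ (bounds i)) (≤-trans (proj₂ (bounds i)) v≤c) wᵢ∈X)

  visible-down-from-clique : ∀ {u v} → toℕ u < c → c < toℕ v → Visible H X v u
  visible-down-from-clique {u} {v} u<c c<v
    with descent (c ∸ toℕ u) u corner (trans toℕ-corner (sym (m∸n+n≡m (<⇒≤ u<c))))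
  ... | w , walk , bounds =
    suc (c ∸ toℕ u) , v Vector.∷ w , (walk-cons H jump walk , shortest) , clean
    where
    jump : adj H v corner ≡ true
    jump = edge⇒adj ((λ v≡corner → <⇒≢ c<v (sym (trans v≡corner toℕ-corner))) ,
                     inj₂ (inj₂ (<⇒≤ c<v , ≤-reflexive (sym toℕ-corner))))
    shortest : ∀ k w′ → Walk H v u k w′ → suc (c ∸ toℕ u) ≤ k
    shortest k w′ walk′ = subst (_≤ k) (trans (cong (_∸ toℕ u) (m≥n⇒m⊓n≡n c<v)) (+-∸-assoc 1 (<⇒≤ u<c)))
      (descent-length {w = w′} (≤-trans (<⇒≤ u<c) (n≤1+n c)) walk′)
    clean : ∀ i → (v Vector.∷ w) i ∈ X → (v Vector.∷ w) i ≡ v ⊎ (v Vector.∷ w) i ≡ u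
    clean zero _ = inj₁ refl
    clean (suc i) wᵢ∈X =
      inj₂ (X-tail-vertex (proj₁ (bounds i)) (≤-trans (proj₂ (bounds i)) (≤-reflexive toℕ-corner)) wᵢ∈X)

  visible-down : ∀ u v → toℕ u < toℕ v → Visible H X v u
  visible-down u v u<v with c ≤? toℕ u | toℕ v ≤? c
  ... | yes c≤u | _ =
    visible-adjacent H X (edge⇒adj (>⇒≢ u<v , inj₂ (inj₂ (≤-trans c≤u (<⇒≤ u<v) , c≤u))))
  ... | no c≰u | yes v≤c = visible-down-within-tail u<v v≤c
  ... | no c≰u | no v≰c = visible-down-from-clique (≰⇒> c≰u) (≰⇒> v≰c)

  X-total : IsVisSet μt H X
  X-total u v with <-cmp (toℕ u) (toℕ v)
  ... | tri< u<v _ _ = visible-sym H {X} {v} {u} (visible-down u v u<v)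
  ... | tri≈ _ u≡v _ = subst (λ x → Visible H X x v) (toℕ-injective (sym u≡v)) (visible-refl H X v)
  ... | tri> _ _ v<u = visible-down v u v<u

  no-three-around-tail : ∀ {Y} → IsVisSet μ H Y → ∀ {x y z} → x ∈ Y → y ∈ Y → z ∈ Y →
    toℕ x < toℕ y → toℕ y < toℕ z → toℕ y ≤ c → ⊥
  no-three-around-tail {Y} Y-mutual {x} {y} {z} x∈Y y∈Y z∈Y x<y y<z y≤c with Y-mutual x z x∈Y z∈Y
  ... | k , w , ((walk , _) , clean) with walk-visits {w = w} x<y y<z y≤c walk
  ... | i , wᵢ≡y with clean i (subst (_∈ Y) (sym wᵢ≡y) y∈Y)
  ... | inj₁ wᵢ≡x = <-irrefl (cong toℕ (trans (sym wᵢ≡x) wᵢ≡y)) x<y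
  ... | inj₂ wᵢ≡z = <-irrefl (cong toℕ (trans (sym wᵢ≡y) wᵢ≡z)) y<z

  mutual-bound : ∀ Y → IsVisSet μ H Y → ∣ Y ∣ ≤ suc (suc r)
  mutual-bound Y Y-mutual
    with any? (λ a → any? (λ b → ((toℕ a <? toℕ b) ×-dec (toℕ b ≤? c)) ×-dec ((a ∈? Y) ×-dec (b ∈? Y))))
  ... | yes (a , b , (a<b , b≤c) , a∈Y , b∈Y) = ≤-trans (⊆pair⇒∣p∣≤2 Y a b only-a-b) (s≤s (s≤s z≤n))
    where
    only-a-b : ∀ e → e ∈ Y → e ≡ a ⊎ e ≡ b
    only-a-b e e∈Y with <-cmp (toℕ e) (toℕ a) | <-cmp (toℕ e) (toℕ b)
    ... | tri< e<a _ _ | _ =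
      ⊥-elim (no-three-around-tail Y-mutual e∈Y a∈Y b∈Y e<a a<b (≤-trans (<⇒≤ a<b) b≤c))
    ... | tri≈ _ e≡a _ | _ = inj₁ (toℕ-injective e≡a)
    ... | tri> _ _ a<e | tri< e<b _ _ =
      ⊥-elim (no-three-around-tail Y-mutual a∈Y e∈Y b∈Y a<e e<b (≤-trans (<⇒≤ e<b) b≤c))
    ... | tri> _ _ _ | tri≈ _ e≡b _ = inj₂ (toℕ-injective e≡b)
    ... | tri> _ _ _ | tri> _ _ b<e = ⊥-elim (no-three-around-tail Y-mutual a∈Y b∈Y e∈Y a<b b<e b≤c)
  ... | no ¬two = injective⇒∣p∣≤n Y (λ e _ → position e) position-injective
    where
    position : Vertex → Fin (suc (suc r))
    position e = fromℕ< (m<n+o⇒m∸n<o (toℕ e) c (subst (toℕ e <_) (sym (+-suc c (suc r))) (toℕ<n e)))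
    toℕ-position : ∀ e → toℕ (position e) ≡ toℕ e ∸ c
    toℕ-position e = toℕ-fromℕ< _
    at-most-one-low : ∀ i j → i ∈ Y → j ∈ Y → toℕ i ≤ c → toℕ j ≤ c → toℕ i ≡ toℕ j
    at-most-one-low i j i∈Y j∈Y i≤c j≤c with <-cmp (toℕ i) (toℕ j)
    ... | tri< i<j _ _ = contradiction (i , j , (i<j , j≤c) , i∈Y , j∈Y) ¬two
    ... | tri≈ _ i≡j _ = i≡j
    ... | tri> _ _ j<i = contradiction (j , i , (j<i , i≤c) , j∈Y , i∈Y) ¬two
    position-injective : ∀ i j (i∈Y : i ∈ Y) (j∈Y : j ∈ Y) → position i ≡ position j → i ≡ j
    position-injective i j i∈Y j∈Y eq = toℕ-injective (∸-injective-above c (at-most-one-low i j i∈Y j∈Y)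
      (trans (sym (toℕ-position i)) (trans (cong toℕ eq) (toℕ-position j))))

  hasValue : ∀ σ → HasValue σ H (suc (suc r))
  hasValue = total-and-mutual-bound⇒hasValue H X-total ∣X∣ mutual-bound

  connected : Connected H
  connected = total⇒connected H X-total

Realisable : Kind → ℕ → ℕ → Set
Realisable σ q p = Σ ℕ λ m → Σ (Graph (suc m)) λ G → Σ (Fin (suc m)) λ x →
  Connected G × Connected (deleteVertex G x) × HasValue σ G q × HasValue σ (deleteVertex G x) p

realisable-equal : ∀ σ r → Realisable σ (suc (suc r)) (suc (suc r))
realisable-equal σ r =
  _ , lollipop 1 _ , zero , G.connected , G-x.connected , G.hasValue σ , G-x.hasValue σ
  where
  module G = Lollipop 1 r (lollipop-isLollipop 1 _)
  module G-x = Lollipop 0 r (lollipop-delete-tail-end 0 _)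

realisable-larger : ∀ σ r d → Realisable σ (suc (suc d + suc r)) (suc (suc r))
realisable-larger σ r d =
  _ , cone H , zero , cone-connected H , H.connected , cone-hasValue H zero≢v ¬zero-v σ , H.hasValue σ
  where
  H = lollipop (suc d) (suc (suc d + suc r))
  module H = Lollipop (suc d) r (lollipop-isLollipop (suc d) _)
  v : Fin (suc (suc d + suc r))
  v = suc (suc (d ↑ʳ zero))
  zero≢v : zero ≢ v
  zero≢v ()
  ¬zero-v : adj H zero v ≡ false
  ¬zero-v = dec-false (lollipopEdge? (suc d) 0 (toℕ v))
    λ { (_ , inj₁ ()) ; (_ , inj₂ (inj₁ ())) ; (_ , inj₂ (inj₂ (() , _))) }

proposition5p1 : (σ : Kind) (p q : ℕ) → 2 ≤ p → p ≤ q →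
    Σ ℕ λ m → Σ (Graph (suc m)) λ G → Σ (Fin (suc m)) λ x →
      Connected G × Connected (deleteVertex G x) × HasValue σ G q × HasValue σ (deleteVertex G x) p
proposition5p1 σ (suc (suc r)) q (s≤s (s≤s _)) p≤q with q ∸ suc (suc r) | m∸n+n≡m p≤q
... | zero  | refl = realisable-equal σ r
... | suc d | refl =
  subst (λ q → Realisable σ q (suc (suc r))) (sym (+-suc (suc d) (suc r))) (realisable-larger σ r d)
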